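{- Let $n\ge 1$, let $f\in B_n$, and let $P=(g_1,\dots,g_t)$ be a program (circuit) over the truth table $f^{\bullet}$. Let $w\in\overline{Pol}(f^{\bullet})$. If $w$ is consistent with $P$, then $P$ does not compute $f$.
   Context: $B_k$ denotes the set of all (total) Boolean functions $\{0,1\}^k\to\{0,1\}$. Enumerate $\{0,1\}^n$ in lexicographic order as $a^1,\dots,a^{2^n}$. The truth table $f^{\bullet}$ is the $2^n\times(n+1)$ Boolean matrix whose $j$-th row is $(a^j_1,\dots,a^j_n,f(a^j))$. Vectors in $\{0,1\}^{2^n}$ are called columns; the columns of $f^{\bullet}$ are $x_1,\dots,x_n$ (with $x_i[j]=a^j_i$) and the result column $r$ (with $r[j]=f(a^j)$). For $w\in B_{2^n}$ and a column $v$, write $w(v)=w(v[1],\dots,v[2^n])$. The set $\overline{Pol}(f^{\bullet})$ consists of all $w\in B_{2^n}$ such that the tuple $(w(x_1),\dots,w(x_n),w(r))$ is not a row of $f^{\bullet}$, i.e. $w(r)\neq f(w(x_1),\dots,w(x_n))$. An $\land$-gate is a triple $(u,v,z)$ of columns with $z=u\land v$ componentwise; an $\lor$-gate is a triple $(u,v,z)$ with $z=u\lor v$ componentwise; a $\neg$-gate is a pair $(u,z)$ with $z=\neg u$ componentwise. Here $u,v$ are the input columns and $z$ the output column; write $\circ_i\in\{\land,\lor,\neg\}$ for the operation of gate $g_i$. An input gate has no input columns and has as output column one of $x_1,\dots,x_n$. A program (circuit) is a sequence $P=(g_1,\dots,g_t)$ of gates such that $g_1,\dots,g_n$ are the input gates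 with outputs $x_1,\dots,x_n$, and for each $i>n$, $g_i$ is an $\land$-, $\lor$- or $\neg$-gate whose input columns are output columns of gates $g_{i_1}$ (and $g_{i_2}$) with $i_1,i_2<i$. $P$ computes $f$ if the output column of $g_t$ equals $r$. The function $w$ is consistent with $P$ if for every non-input gate $g_i$ with input columns $u,v$ (resp. $u$) and output column $z$ one has $w(z)=w(u)\circ_i w(v)$ (resp. $w(z)=\neg w(u)$). -}

module Defs where

open import Data.Nat using (ℕ; zero; suc; _^_; _≤_; _<_)
open import Data.Bool using (Bool; true; false; _∧_; _∨_; not)
open import Data.Fin using (Fin; toℕ; fromℕ<)
open import Data.Vec using (Vec; []; _∷_; _++_; map; lookup; tabulate; zipWith)
open import Data.Product using (Σ; _×_)
open import Data.Empty using (⊥)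
open import Data.Unit using (⊤)
open import Relation.Binary.PropositionalEquality using (_≡_; _≢_)

B : ℕ → Set
B k = Vec Bool k → Bool

-- lexicographic enumeration a^1,…,a^(2^n) of {0,1}^n (false < true, first coordinate most significant)
rows : (n : ℕ) → Vec (Vec Bool n) (2 ^ n)
rows zero = [] ∷ []
rows (suc n) = map (false ∷_) (rows n) ++ (map (true ∷_) (rows n) ++ [])

Column : ℕ → Set
Column n = Vec Bool (2 ^ n)

xcol : {n : ℕ} → Fin n → Column n
xcol {n} i = map (λ a → lookup a i) (rows n)

rcol : {n : ℕ} → B n → Column n
rcol {n} f = map f (rows n)

NotPol : {n : ℕ} → B n → B (2 ^ n) → Set
NotPol {n} f w = w (rcol f) ≢ f (tabulate (λ i → w (xcol i)))

data Gate {n : ℕ} (t : ℕ) : Set where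
  input : Fin n → Gate t
  andG  : Fin t → Fin t → Gate t
  orG   : Fin t → Fin t → Gate t
  notG  : Fin t → Gate t

NonInputOK : {n t : ℕ} → Fin t → Gate {n} t → (Fin t → Column n) → Set
NonInputOK i (input _) col = ⊥
NonInputOK i (andG j k) col = toℕ j < toℕ i × toℕ k < toℕ i × col i ≡ zipWith _∧_ (col j) (col k)
NonInputOK i (orG j k) col = toℕ j < toℕ i × toℕ k < toℕ i × col i ≡ zipWith _∨_ (col j) (col k)
NonInputOK i (notG j) col = toℕ j < toℕ i × col i ≡ map not (col j)

-- a program P = (g_1,…,g_t) over the truth table (gate index i : Fin t stands for g_(i+1))
record Program (n : ℕ) : Set where
  field
    t        : ℕ
    n≤t      : n ≤ t
    gate     : Fin t → Gate {n} t
    col      : Fin t → Column n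
    inputsOK : (i : Fin t) (lt : toℕ i < n) →
               (gate i ≡ input (fromℕ< lt)) × (col i ≡ xcol (fromℕ< lt))
    gatesOK  : (i : Fin t) → n ≤ toℕ i → NonInputOK i (gate i) col

open Program public

Computes : {n : ℕ} → Program n → B n → Set
Computes P f = Σ (Fin (t P)) (λ i → (suc (toℕ i) ≡ t P) × (col P i ≡ rcol f))

GateConsistent : {n t : ℕ} → B (2 ^ n) → Fin t → Gate {n} t → (Fin t → Column n) → Set
GateConsistent w i (input _) col = ⊤
GateConsistent w i (andG j k) col = w (col i) ≡ (w (col j) ∧ w (col k))
GateConsistent w i (orG j k) col = w (col i) ≡ (w (col j) ∨ w (col k))
GateConsistent w i (notG j) col = w (col i) ≡ not (w (col j))

Consistent : {n : ℕ} → B (2 ^ n) → Program n → Set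
Consistent {n} w P = (i : Fin (t P)) → n ≤ toℕ i → GateConsistent w i (gate P i) (col P)

-- Every column produced by P is the truth table of some h ∈ B_n, and a w consistent with P
-- acts on it as evaluation of h at the point a = (w(x_1),…,w(x_n)): this holds for the input
-- columns x_i (h = i-th projection) and is preserved by ∧, ∨, ¬ gates.  If P computed f, its
-- output column would be the truth table of f; as the rows enumerate all of {0,1}^n this
-- forces w(r) = f(a), contradicting w ∈ \overline{Pol}(f^•).
module Submission where

open import Defs
open import Data.Nat using (ℕ; _≤_; _<_; _^_; _<?_)
open import Data.Nat.Properties using (≮⇒≥)
open import Data.Bool using (Bool; true; false; _∧_; _∨_; not)
open import Data.Fin using (Fin; toℕ; fromℕ<)
open import Data.Fin.Induction using (<-wellFounded)
open import Data.Vec using (Vec; []; _∷_; head; tail; map; lookup; tabulate; zipWith)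
open import Data.Vec.Properties using (map-∘; lookup∘tabulate)
open import Data.Vec.Membership.Propositional using (_∈_)
open import Data.Vec.Membership.Propositional.Properties using (∈-map⁺; ∈-++⁺ˡ; ∈-++⁺ʳ)
open import Data.Vec.Relation.Unary.Any using (here; there)
open import Data.Product using (Σ; _×_; _,_; proj₂)
open import Induction.WellFounded using (module All)
open import Relation.Nullary using (¬_; yes; no)
open import Relation.Binary.PropositionalEquality using (_≡_; refl; sym; trans; cong; cong₂; subst)

zipWith-map-map : ∀ {A B C D : Set} {k} (_⊕_ : B → C → D) (g : A → B) (h : A → C) (xs : Vec A k) →
                  zipWith _⊕_ (map g xs) (map h xs) ≡ map (λ x → g x ⊕ h x) xs
zipWith-map-map _⊕_ g h []       = refl
zipWith-map-map _⊕_ g h (x ∷ xs) = cong (g x ⊕ h x ∷_) (zipWith-map-map _⊕_ g h xs)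

map-≡⇒≡-on-∈ : ∀ {A B : Set} {k} {g h : A → B} {xs : Vec A k} {x : A} →
               map g xs ≡ map h xs → x ∈ xs → g x ≡ h x
map-≡⇒≡-on-∈ eq (here refl) = cong head eq
map-≡⇒≡-on-∈ eq (there x∈xs) = map-≡⇒≡-on-∈ (cong tail eq) x∈xs

∈-rows : ∀ {n} (v : Vec Bool n) → v ∈ rows n
∈-rows []          = here refl
∈-rows (false ∷ v) = ∈-++⁺ˡ (∈-map⁺ (false ∷_) (∈-rows v))
∈-rows (true ∷ v)  = ∈-++⁺ʳ (map (false ∷_) (rows _)) (∈-++⁺ˡ (∈-map⁺ (true ∷_) (∈-rows v)))

truthTable : ∀ {n} → B n → Column n
truthTable {n} h = map h (rows n)

truthTable-injective : ∀ {n} {g h : B n} → truthTable g ≡ truthTable h → ∀ v → g v ≡ h v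
truthTable-injective eq v = map-≡⇒≡-on-∈ eq (∈-rows v)

module _ {n : ℕ} (w : B (2 ^ n)) where

  evaluationPoint : Vec Bool n
  evaluationPoint = tabulate (λ i → w (xcol i))

  Evaluates : Column n → Set
  Evaluates c = Σ (B n) λ h → (c ≡ truthTable h) × (w c ≡ h evaluationPoint)

  xcol-evaluates : (i : Fin n) → Evaluates (xcol i)
  xcol-evaluates i = (λ a → lookup a i) , refl , sym (lookup∘tabulate (λ j → w (xcol j)) i)

  zipWith-evaluates : ∀ (_⊕_ : Bool → Bool → Bool) {c c₁ c₂} →
                      c ≡ zipWith _⊕_ c₁ c₂ → w c ≡ w c₁ ⊕ w c₂ →
                      Evaluates c₁ → Evaluates c₂ → Evaluates c
  zipWith-evaluates _⊕_ c≡ wc≡ (g , refl , wc₁≡) (h , refl , wc₂≡) =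
    (λ v → g v ⊕ h v) ,
    trans c≡ (zipWith-map-map _⊕_ g h (rows n)) ,
    trans wc≡ (cong₂ _⊕_ wc₁≡ wc₂≡)

  not-evaluates : ∀ {c c₁} → c ≡ map not c₁ → w c ≡ not (w c₁) → Evaluates c₁ → Evaluates c
  not-evaluates c≡ wc≡ (h , refl , wc₁≡) =
    (λ v → not (h v)) , trans c≡ (sym (map-∘ not h (rows n))) , trans wc≡ (cong not wc₁≡)

  gate-evaluates : ∀ {t} (col : Fin t → Column n) i (g : Gate {n} t) →
                   NonInputOK i g col → GateConsistent w i g col →
                   (∀ {j} → toℕ j < toℕ i → Evaluates (col j)) → Evaluates (col i)
  gate-evaluates col i (andG j k) (j<i , k<i , c≡) wc≡ ih = zipWith-evaluates _∧_ c≡ wc≡ (ih j<i) (ih k<i)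
  gate-evaluates col i (orG j k)  (j<i , k<i , c≡) wc≡ ih = zipWith-evaluates _∨_ c≡ wc≡ (ih j<i) (ih k<i)
  gate-evaluates col i (notG j)   (j<i , c≡)       wc≡ ih = not-evaluates c≡ wc≡ (ih j<i)

  col-evaluates : (P : Program n) → Consistent w P → ∀ i → Evaluates (col P i)
  col-evaluates P consistent = All.wfRec <-wellFounded _ (λ i → Evaluates (col P i)) step
    where
    step : ∀ i → (∀ {j} → toℕ j < toℕ i → Evaluates (col P j)) → Evaluates (col P i)
    step i ih with toℕ i <? n
    ... | yes i<n = subst Evaluates (sym (proj₂ (inputsOK P i i<n))) (xcol-evaluates (fromℕ< i<n))
    ... | no i≮n  = gate-evaluates (col P) i (gate P i) (gatesOK P i n≤i) (consistent i n≤i) ih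
      where
      n≤i : n ≤ toℕ i
      n≤i = ≮⇒≥ i≮n

mainTheorem1 : (n : ℕ) → 1 ≤ n → (f : B n) (P : Program n) (w : B (2 ^ n)) →
    NotPol f w → Consistent w P → ¬ Computes P f
mainTheorem1 n _ f P w w∉Pol consistent (i , _ , cᵢ≡r) with col-evaluates w P consistent i
... | h , cᵢ≡h , wcᵢ≡ = w∉Pol wr≡fa
  where
  h≗f : ∀ v → h v ≡ f v
  h≗f = truthTable-injective (trans (sym cᵢ≡h) cᵢ≡r)

  wr≡fa : w (rcol f) ≡ f (evaluationPoint w)
  wr≡fa = trans (cong w (sym cᵢ≡r)) (trans wcᵢ≡ (h≗f (evaluationPoint w)))
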